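{- For every positive integer $k$ there is a bridgeless cubic graph with exactly $k$ lonely edges.
   Context: Graphs may have parallel edges. An edge of a graph is lonely if it belongs to exactly one perfect matching of the graph. -}

module Defs where

open import Data.Nat using (ℕ)
open import Data.Fin using (Fin; _≟_)
open import Data.Fin.Subset using (Subset; _∈_; ∣_∣)
open import Data.Product using (Σ; _×_; _,_; proj₁; proj₂; ∃)
open import Data.Sum using (_⊎_)
open import Data.List using (List; filter; length)
open import Data.List using (allFin)
open import Relation.Nullary using (¬_; Dec; yes; no)
open import Relation.Binary.PropositionalEquality using (_≡_; _≢_)
open import Function.Bundles using (_⇔_)

-- A finite loopless multigraph: vertices Fin n, edges Fin m (parallel edges
-- allowed), each edge has two distinct endpoints.
record Graph : Set where
  field
    n    : ℕ
    m    : ℕ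
    end₁ : Fin m → Fin n
    end₂ : Fin m → Fin n
    loopless : ∀ e → end₁ e ≢ end₂ e

module _ (G : Graph) where
  open Graph G

  Incident : Fin n → Fin m → Set
  Incident v e = (end₁ e ≡ v) ⊎ (end₂ e ≡ v)

  incident? : (v : Fin n) (e : Fin m) → Dec (Incident v e)
  incident? v e with end₁ e ≟ v | end₂ e ≟ v
  ... | yes p | _     = yes (Data.Sum.inj₁ p)
  ... | no _  | yes q = yes (Data.Sum.inj₂ q)
  ... | no ¬p | no ¬q = no λ { (Data.Sum.inj₁ p) → ¬p p ; (Data.Sum.inj₂ q) → ¬q q }

  -- number of edges incident with v (loopless, so this is the degree)
  degree : Fin n → ℕ
  degree v = length (filter (incident? v) (allFin m))

  Cubic : Set
  Cubic = ∀ v → degree v ≡ 3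

  -- walks in G − a (edge a deleted)
  data ReachAvoiding (a : Fin m) : Fin n → Fin n → Set where
    here : ∀ {x} → ReachAvoiding a x x
    step : ∀ {x z} (f : Fin m) → f ≢ a →
           Incident x f → ∀ {y} → Incident y f →
           ReachAvoiding a y z → ReachAvoiding a x z

  IsBridge : Fin m → Set
  IsBridge e = ¬ ReachAvoiding e (end₁ e) (end₂ e)

  Bridgeless : Set
  Bridgeless = ∀ e → ¬ IsBridge e

  IsPerfectMatching : Subset m → Set
  IsPerfectMatching M =
    ∀ v → Σ (Fin m) λ e → e ∈ M × Incident v e ×
          (∀ f → f ∈ M → Incident v f → f ≡ e)

  Lonely : Fin m → Set
  Lonely e = Σ (Subset m) λ M → IsPerfectMatching M × e ∈ M ×
             (∀ M′ → IsPerfectMatching M′ → e ∈ M′ → M′ ≡ M)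

  HasExactlyLonely : ℕ → Set
  HasExactlyLonely k = Σ (Subset m) λ L → ∣ L ∣ ≡ k × (∀ e → (e ∈ L) ⇔ Lonely e)

-- For k ≥ 2 take k digons (pairs of vertices joined by two parallel edges) arranged in a ring, consecutive
-- digons being joined by a connector. A perfect matching containing a connector cannot use the digon it
-- enters, so it contains the connector leaving that digon; going round the ring, it consists of all
-- connectors, which are therefore lonely. A digon edge is not lonely, since one edge can be chosen in every
-- digon independently. For k = 1 take the 10-cycle 0, 1, …, 9 with chords 05, 13, 29, 48 and 67: a perfect
-- matching containing the cycle edge 90 is forced, after one case split, to be the alternating matching
-- {90, 12, 34, 56, 78}, while every other edge lies in two of eight explicit perfect matchings. Both graphs
-- have a Hamiltonian cycle, so neither has a bridge.
module Submission where

open import Defs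
open import Level using (0ℓ)
open import Function using (_∘_; id; case_of_)
open import Function.Bundles using (_⇔_; mk⇔; Equivalence)
open import Function.Definitions using (Injective)
import Function.Properties.Equivalence as ⇔
open import Data.Nat using (ℕ; zero; suc; _*_; _≤_)
import Data.Nat as ℕ
import Data.Bool as Bool
open import Data.Product using (Σ; ∃; ∃₂; _×_; _,_; proj₁; proj₂; uncurry)
open import Data.Sum using (_⊎_; inj₁; inj₂)
open import Data.Empty using (⊥-elim)
open import Data.Fin
  using (Fin; zero; suc; fromℕ; inject₁; combine; remQuot; splitAt; _↑ˡ_; opposite; punchIn; _≟_)
open import Data.Fin.Properties
  using (suc-injective; fromℕ≢inject₁; inject₁-injective; combine-remQuot; remQuot-combine;
         combine-injectiveˡ; combine-injectiveʳ; splitAt-↑ˡ; ↑ˡ-injective; punchInᵢ≢i; all?; any?)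
open import Data.Fin.Patterns using (0F; 1F; 2F)
open import Data.Fin.Relation.Unary.Top using (view; ‵fromℕ; ‵inject₁)
open import Data.Fin.Subset using (Subset; _∈_; _∉_; _⊆_; ∣_∣; ⁅_⁆; _∪_; ⊥)
open import Data.Fin.Subset.Properties
  using (_∈?_; ⊆-antisym; x∈p∪q⁻; x∈⁅y⁆⇒x≡y; x∈⁅y⁆⇔x≡y; x∉⁅y⁆⇒x≢y; ∣⁅x⁆∣≡1; ∉⊥)
open import Data.List using (List; []; _∷_; filter; length; allFin)
open import Data.List.Membership.Propositional using () renaming (_∈_ to _∈ₗ_)
open import Data.List.Membership.Propositional.Properties using (∈-filter⁺; ∈-filter⁻; ∈-allFin)
open import Data.List.Membership.Propositional.Properties.WithK using (unique∧set⇒bag)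
open import Data.List.Relation.Unary.All as All using (All; []; _∷_)
open import Data.List.Relation.Unary.AllPairs using ([]; _∷_)
open import Data.List.Relation.Unary.Any using (here; there)
open import Data.List.Relation.Unary.Unique.Propositional using (Unique)
open import Data.List.Relation.Unary.Unique.Propositional.Properties using (filter⁺; allFin⁺)
open import Data.List.Relation.Binary.BagAndSetEquality using (∼bag⇒↭)
open import Data.List.Relation.Binary.Permutation.Propositional.Properties using (↭-length)
open import Data.Vec using (Vec; []; _∷_; concat; tabulate; lookup)
open import Data.Vec.Functional using (updateAt)
open import Data.Vec.Functional.Properties using (updateAt-updates; updateAt-minimal)
open import Data.Vec.Properties using (≡-dec; lookup-concat; lookup∘tabulate; []=⇒lookup; lookup⇒[]=)
open import Relation.Binary.Bundles using (Setoid)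
open import Relation.Binary.PropositionalEquality using (_≡_; _≢_; refl; sym; trans; cong; subst; subst₂)
open import Relation.Nullary using (¬_; Dec; yes; no)
open import Relation.Nullary.Decidable
  using (_×-dec_; _→-dec_; ¬?; decidable-stable; True; False; toWitness; toWitnessFalse)

blocks : ∀ {k l} → (Fin k → Subset l) → Subset (k * l)
blocks b = concat (tabulate b)

∈-blocks : ∀ {k l} (b : Fin k → Subset l) i j → combine i j ∈ blocks b ⇔ j ∈ b i
∈-blocks b i j = mk⇔ (λ p → lookup⇒[]= j (b i) (trans (sym lookup-blocks) ([]=⇒lookup p)))
                     (λ p → lookup⇒[]= (combine i j) (blocks b) (trans lookup-blocks ([]=⇒lookup p)))
  where
  lookup-blocks : lookup (blocks b) (combine i j) ≡ lookup (b i) j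
  lookup-blocks = trans (lookup-concat (tabulate b) i j) (cong (λ p → lookup p j) (lookup∘tabulate b i))

fromList : ∀ {n} → List (Fin n) → Subset n
fromList []       = ⊥
fromList (x ∷ xs) = ⁅ x ⁆ ∪ fromList xs

fromList-⊆ : ∀ {n} {xs : List (Fin n)} {p} → All (_∈ p) xs → fromList xs ⊆ p
fromList-⊆ [] x∈ = ⊥-elim (∉⊥ x∈)
fromList-⊆ {xs = y ∷ ys} (y∈p ∷ ys⊆p) x∈ with x∈p∪q⁻ ⁅ y ⁆ (fromList ys) x∈
... | inj₁ x∈y  = subst (_∈ _) (sym (x∈⁅y⁆⇒x≡y y x∈y)) y∈p
... | inj₂ x∈ys = fromList-⊆ ys⊆p x∈ys

prev : ∀ {l} → Fin (suc l) → Fin (suc l)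
prev zero    = fromℕ _
prev (suc i) = inject₁ i

prev-injective : ∀ {l} {i j : Fin (suc l)} → prev i ≡ prev j → i ≡ j
prev-injective {i = zero}  {zero}  _  = refl
prev-injective {i = zero}  {suc j} eq = ⊥-elim (fromℕ≢inject₁ eq)
prev-injective {i = suc i} {zero}  eq = ⊥-elim (fromℕ≢inject₁ (sym eq))
prev-injective {i = suc i} {suc j} eq = cong suc (inject₁-injective eq)

prev-surjective : ∀ {l} (j : Fin (suc l)) → ∃ λ i → prev i ≡ j
prev-surjective j with view j
... | ‵fromℕ     = zero , refl
... | ‵inject₁ i = suc i , refl

module CyclicChain {c ℓ} (S : Setoid c ℓ) where
  open Setoid S using (Carrier; _≈_) renaming (refl to ≈-refl; sym to ≈-sym; trans to ≈-trans)

  chain : ∀ {l} (a : Fin (suc l) → Carrier) → (∀ i → a (inject₁ i) ≈ a (suc i)) → ∀ i → a zero ≈ a i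
  chain a links zero            = ≈-refl
  chain {suc l} a links (suc i) = ≈-trans (links zero) (chain (a ∘ suc) (links ∘ suc) i)

  missing-link : ∀ {l} (a : Fin (suc l) → Carrier) (p : Fin (suc l)) →
                 (∀ i → i ≢ p → a (prev i) ≈ a i) → a (prev p) ≈ a p
  missing-link a zero    links = ≈-sym (chain a (λ i → links (suc i) λ ()) (fromℕ _))
  missing-link a (suc p) links =
    broken a (links zero λ ()) p (λ i i≢p → links (suc i) (i≢p ∘ suc-injective))
    where
    broken : ∀ {l} (a : Fin (suc l) → Carrier) → a (fromℕ l) ≈ a zero → (p : Fin l) →
             (∀ i → i ≢ p → a (inject₁ i) ≈ a (suc i)) → a (inject₁ p) ≈ a (suc p)
    broken a closing zero links =
      ≈-sym (≈-trans (chain (a ∘ suc) (λ i → links (suc i) λ ()) (fromℕ _)) closing)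
    broken a closing (suc p) links =
      broken (a ∘ suc) (≈-trans closing (links zero λ ())) p
        (λ i i≢p → links (suc i) (i≢p ∘ suc-injective))

-- Walks, stars and perfect matchings in a graph

module _ (G : Graph) where
  open Graph G

  -- A data type rather than a sum of equations, so that e, x and y can be inferred from a proof.
  data Joins (e : Fin m) (x y : Fin n) : Set where
    forward  : end₁ e ≡ x → end₂ e ≡ y → Joins e x y
    backward : end₁ e ≡ y → end₂ e ≡ x → Joins e x y

  joins-incidentˡ : ∀ {e x y} → Joins e x y → Incident G x e
  joins-incidentˡ (forward p _)  = inj₁ p
  joins-incidentˡ (backward _ p) = inj₂ p

  joins-incidentʳ : ∀ {e x y} → Joins e x y → Incident G y e
  joins-incidentʳ (forward _ p)  = inj₂ p
  joins-incidentʳ (backward p _) = inj₁ p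

  joins-ends : ∀ {e x y v} → Joins e x y → Incident G v e → v ≡ x ⊎ v ≡ y
  joins-ends (forward refl _)  (inj₁ refl) = inj₁ refl
  joins-ends (forward _ refl)  (inj₂ refl) = inj₂ refl
  joins-ends (backward refl _) (inj₁ refl) = inj₂ refl
  joins-ends (backward _ refl) (inj₂ refl) = inj₁ refl

  reach-trans : ∀ {e x y z} → ReachAvoiding G e x y → ReachAvoiding G e y z → ReachAvoiding G e x z
  reach-trans here                   q = q
  reach-trans (step f f≢e x∈f y∈f p) q = step f f≢e x∈f y∈f (reach-trans p q)

  reach-sym : ∀ {e x y} → ReachAvoiding G e x y → ReachAvoiding G e y x
  reach-sym here                   = here
  reach-sym (step f f≢e x∈f y∈f p) = reach-trans (reach-sym p) (step f f≢e y∈f x∈f here)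

  reach-edge : ∀ {e f x y} → f ≢ e → Joins f x y → ReachAvoiding G e x y
  reach-edge f≢e xy = step _ f≢e (joins-incidentˡ xy) (joins-incidentʳ xy) here

  reach-setoid : Fin m → Setoid 0ℓ 0ℓ
  reach-setoid e = record
    { Carrier       = Fin n
    ; _≈_           = ReachAvoiding G e
    ; isEquivalence = record { refl = here ; sym = reach-sym ; trans = reach-trans }
    }

  not-bridge : ∀ {e x y} → Joins e x y → ReachAvoiding G e x y → ¬ IsBridge G e
  not-bridge (forward refl refl)  x~y bridge = bridge x~y
  not-bridge (backward refl refl) x~y bridge = bridge (reach-sym x~y)

  hamiltonian⇒bridgeless : ∀ {l} (a : Fin (suc l) → Fin n) (h : Fin (suc l) → Fin m) →
    (∀ v → ∃ λ i → a i ≡ v) → Injective _≡_ _≡_ h → (∀ i → Joins (h i) (a (prev i)) (a i)) → Bridgeless G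
  hamiltonian⇒bridgeless a h onto h-injective cycle e with any? (λ p → h p ≟ e)
  ... | yes (p , refl) = not-bridge (cycle p)
    (CyclicChain.missing-link (reach-setoid (h p)) a p
      (λ i i≢p → reach-edge (i≢p ∘ h-injective) (cycle i)))
  ... | no off-cycle = λ bridge → bridge
    (subst₂ (ReachAvoiding G e) (proj₂ (onto _)) (proj₂ (onto _)) (reach-trans (reach-sym (along _)) (along _)))
    where
    along : ∀ i → ReachAvoiding G e (a zero) (a i)
    along = CyclicChain.chain (reach-setoid e) a
      (λ i → reach-edge (λ h≡e → off-cycle (suc i , h≡e)) (cycle (suc i)))

  EdgesAt : Fin n → List (Fin m) → Set
  EdgesAt v es = ∀ f → Incident G v f ⇔ f ∈ₗ es

  incidentEdges : Fin n → List (Fin m)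
  incidentEdges v = filter (incident? G v) (allFin m)

  edgesAt-incidentEdges : ∀ v → EdgesAt v (incidentEdges v)
  edgesAt-incidentEdges v f =
    mk⇔ (∈-filter⁺ (incident? G v) (∈-allFin f)) (proj₂ ∘ ∈-filter⁻ (incident? G v) {xs = allFin m})

  degree-edgesAt : ∀ {v es} → Unique es → EdgesAt v es → degree G v ≡ length es
  degree-edgesAt {v} es! star = ↭-length (∼bag⇒↭ (unique∧set⇒bag (filter⁺ (incident? G v) (allFin⁺ m)) es!
    (λ {f} → ⇔.trans (⇔.sym (edgesAt-incidentEdges v f)) (star f))))

  UniquelyCovered : Subset m → Fin n → Set
  UniquelyCovered M v = Σ (Fin m) λ e → e ∈ M × Incident G v e × (∀ f → f ∈ M → Incident G v f → f ≡ e)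

  perfectMatching? : ∀ M → Dec (IsPerfectMatching G M)
  perfectMatching? M = all? λ v → any? λ e → (e ∈? M) ×-dec (incident? G v e ×-dec
    all? λ f → (f ∈? M) →-dec (incident? G v f →-dec (f ≟ e)))

  covered-by : ∀ {M e v es} → EdgesAt v es → e ∈ₗ es → e ∈ M → All (λ f → f ∈ M → f ≡ e) es →
               UniquelyCovered M v
  covered-by star e∈es e∈M only =
    _ , e∈M , Equivalence.from (star _) e∈es ,
    λ f f∈M v∈f → All.lookup only (Equivalence.to (star f) v∈f) f∈M

  matched-unique : ∀ {M e f v} → IsPerfectMatching G M → e ∈ M → f ∈ M →
                   Incident G v e → Incident G v f → f ≡ e
  matched-unique {v = v} pm e∈M f∈M v∈e v∈f with pm v
  ... | _ , _ , _ , only = trans (only _ f∈M v∈f) (sym (only _ e∈M v∈e))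

  excluded : ∀ {M e f v} → IsPerfectMatching G M → e ∈ M → Incident G v e → Incident G v f → f ≢ e → f ∉ M
  excluded pm e∈M v∈e v∈f f≢e f∈M = f≢e (matched-unique pm e∈M f∈M v∈e v∈f)

  forced : ∀ {M f v es} → IsPerfectMatching G M → EdgesAt v es → All (λ g → g ≡ f ⊎ g ∉ M) es → f ∈ M
  forced {v = v} pm star others with pm v
  ... | g , g∈M , v∈g , _ with All.lookup others (Equivalence.to (star g) v∈g)
  ...   | inj₁ refl = g∈M
  ...   | inj₂ g∉M  = ⊥-elim (g∉M g∈M)

  ⊆-perfect⇒≡ : ∀ {M N} → IsPerfectMatching G M → IsPerfectMatching G N → N ⊆ M → M ≡ N
  ⊆-perfect⇒≡ {M} {N} pmM pmN N⊆M = ⊆-antisym M⊆N N⊆M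
    where
    M⊆N : M ⊆ N
    M⊆N {f} f∈M with pmN (end₁ f)
    ... | g , g∈N , v∈g , _ = subst (_∈ N) (sym (matched-unique pmM (N⊆M g∈N) f∈M v∈g (inj₁ refl))) g∈N

  two-matchings⇒¬lonely : ∀ {M₁ M₂ e} → IsPerfectMatching G M₁ → IsPerfectMatching G M₂ →
                          e ∈ M₁ → e ∈ M₂ → M₁ ≢ M₂ → ¬ Lonely G e
  two-matchings⇒¬lonely pm₁ pm₂ e∈M₁ e∈M₂ M₁≢M₂ (_ , _ , _ , unique) =
    M₁≢M₂ (trans (unique _ pm₁ e∈M₁) (sym (unique _ pm₂ e∈M₂)))

  exactly-lonely : ∀ {k} (L : Subset m) → ∣ L ∣ ≡ k →
                   (∀ e → e ∈ L → Lonely G e) → (∀ e → e ∉ L → ¬ Lonely G e) → HasExactlyLonely G k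
  exactly-lonely L ∣L∣≡k lonely not-lonely = L , ∣L∣≡k , λ e →
    mk⇔ (lonely e) (λ e-lonely → decidable-stable (e ∈? L) (λ e∉L → not-lonely e e∉L e-lonely))

-- Rings of digons

-- Vertices and edges are numbered by `combine`, with a tag as second coordinate: digon j is {X j, Y j}
-- with its two parallel edges, and connector j runs from digon (prev j) to digon j.
module Ring (q : ℕ) where

  X Y : Fin (suc q) → Fin (suc q * 2)
  X j = combine j 0F
  Y j = combine j 1F

  endpoints : Fin (suc q) × Fin 3 → Fin (suc q * 2) × Fin (suc q * 2)
  endpoints (j , 0F) = X j , Y j
  endpoints (j , 1F) = X j , Y j
  endpoints (j , 2F) = Y (prev j) , X j

  X-injective : ∀ i j → X i ≡ X j → i ≡ j
  X-injective i j = combine-injectiveˡ i 0F j 0F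

  Y-injective : ∀ i j → Y i ≡ Y j → i ≡ j
  Y-injective i j = combine-injectiveˡ i 1F j 1F

  X≢Y : ∀ i j → X i ≢ Y j
  X≢Y i j eq with combine-injectiveʳ i 0F j 1F eq
  ... | ()

  endpoints-distinct : ∀ p → proj₁ (endpoints p) ≢ proj₂ (endpoints p)
  endpoints-distinct (j , 0F) = X≢Y j j
  endpoints-distinct (j , 1F) = X≢Y j j
  endpoints-distinct (j , 2F) = X≢Y j (prev j) ∘ sym

  graph : Graph
  graph = record
    { n        = suc q * 2
    ; m        = suc q * 3
    ; end₁     = proj₁ ∘ endpoints ∘ remQuot 3
    ; end₂     = proj₂ ∘ endpoints ∘ remQuot 3
    ; loopless = endpoints-distinct ∘ remQuot 3
    }

  digon : Fin 2 → Fin (suc q) → Fin (suc q * 3)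
  digon t j = combine j (inject₁ t)

  connector : Fin (suc q) → Fin (suc q * 3)
  connector j = combine j 2F

  different-tags : ∀ i j {s t : Fin 3} → s ≢ t → combine {suc q} i s ≢ combine j t
  different-tags i j {s} {t} s≢t = s≢t ∘ combine-injectiveʳ i s j t

  digon₀≢digon₁ : ∀ i j → digon 0F i ≢ digon 1F j
  digon₀≢digon₁ i j = different-tags i j λ ()

  digon≢connector : ∀ t i j → digon t i ≢ connector j
  digon≢connector t i j = different-tags i j (fromℕ≢inject₁ ∘ sym)

  joins-endpoints : ∀ j t →
                    Joins graph (combine j t) (proj₁ (endpoints (j , t))) (proj₂ (endpoints (j , t)))
  joins-endpoints j t = forward (cong (proj₁ ∘ endpoints) (remQuot-combine j t))
                                (cong (proj₂ ∘ endpoints) (remQuot-combine j t))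

  digon-joins : ∀ t j → Joins graph (digon t j) (X j) (Y j)
  digon-joins 0F j = joins-endpoints j 0F
  digon-joins 1F j = joins-endpoints j 1F

  connector-joins : ∀ j → Joins graph (connector j) (Y (prev j)) (X j)
  connector-joins j = joins-endpoints j 2F

  data EdgeView : Fin (suc q * 3) → Set where
    digon-edge     : ∀ t j → EdgeView (digon t j)
    connector-edge : ∀ j → EdgeView (connector j)

  edge-view : ∀ e → EdgeView e
  edge-view e = subst EdgeView (combine-remQuot 3 e) (classify (remQuot 3 e))
    where
    classify : ∀ p → EdgeView (uncurry combine p)
    classify (j , 0F) = digon-edge 0F j
    classify (j , 1F) = digon-edge 1F j
    classify (j , 2F) = connector-edge j

  data VertexView : Fin (suc q * 2) → Set where
    at-X : ∀ j → VertexView (X j)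
    at-Y : ∀ i → VertexView (Y (prev i))

  vertex-view : ∀ v → VertexView v
  vertex-view v = subst VertexView (combine-remQuot 2 v) (classify (remQuot 2 v))
    where
    classify : ∀ p → VertexView (uncurry combine p)
    classify (j , 0F) = at-X j
    classify (j , 1F) with prev-surjective j
    ... | i , refl = at-Y i

  star : Fin (suc q) → Fin (suc q) → List (Fin (suc q * 3))
  star j i = digon 0F j ∷ digon 1F j ∷ connector i ∷ []

  digon∈star : ∀ t j i → digon t j ∈ₗ star j i
  digon∈star 0F j i = here refl
  digon∈star 1F j i = there (here refl)

  connector∈star : ∀ j i → connector i ∈ₗ star j i
  connector∈star j i = there (there (here refl))

  star-unique : ∀ j i → Unique (star j i)
  star-unique j i =
    (digon₀≢digon₁ j j ∷ digon≢connector 0F j i ∷ []) ∷ (digon≢connector 1F j i ∷ []) ∷ [] ∷ []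

  edgesAt-X : ∀ j → EdgesAt graph (X j) (star j j)
  edgesAt-X j f = mk⇔ (to f) from
    where
    to : ∀ f → Incident graph (X j) f → f ∈ₗ star j j
    to f v∈f with edge-view f
    to _ v∈f | digon-edge t i with joins-ends graph (digon-joins t i) v∈f
    ... | inj₁ Xj≡Xi rewrite X-injective j i Xj≡Xi = digon∈star t i i
    ... | inj₂ Xj≡Yi = ⊥-elim (X≢Y j i Xj≡Yi)
    to _ v∈f | connector-edge i with joins-ends graph (connector-joins i) v∈f
    ... | inj₁ Xj≡Y = ⊥-elim (X≢Y j (prev i) Xj≡Y)
    ... | inj₂ Xj≡Xi rewrite X-injective j i Xj≡Xi = connector∈star i i
    from : ∀ {f} → f ∈ₗ star j j → Incident graph (X j) f
    from (here refl)                 = joins-incidentˡ graph (digon-joins 0F j)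
    from (there (here refl))         = joins-incidentˡ graph (digon-joins 1F j)
    from (there (there (here refl))) = joins-incidentʳ graph (connector-joins j)

  edgesAt-Y : ∀ i → EdgesAt graph (Y (prev i)) (star (prev i) i)
  edgesAt-Y i f = mk⇔ (to f) from
    where
    to : ∀ f → Incident graph (Y (prev i)) f → f ∈ₗ star (prev i) i
    to f v∈f with edge-view f
    to _ v∈f | digon-edge t j with joins-ends graph (digon-joins t j) v∈f
    ... | inj₁ Y≡Xj = ⊥-elim (X≢Y j (prev i) (sym Y≡Xj))
    ... | inj₂ Y≡Yj rewrite Y-injective (prev i) j Y≡Yj = digon∈star t j i
    to _ v∈f | connector-edge j with joins-ends graph (connector-joins j) v∈f
    ... | inj₁ Y≡Y rewrite prev-injective {i = i} {j} (Y-injective (prev i) (prev j) Y≡Y) =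
      connector∈star (prev j) j
    ... | inj₂ Y≡Xj = ⊥-elim (X≢Y j (prev i) (sym Y≡Xj))
    from : ∀ {f} → f ∈ₗ star (prev i) i → Incident graph (Y (prev i)) f
    from (here refl)                 = joins-incidentʳ graph (digon-joins 0F (prev i))
    from (there (here refl))         = joins-incidentʳ graph (digon-joins 1F (prev i))
    from (there (there (here refl))) = joins-incidentˡ graph (connector-joins i)

  cubic : Cubic graph
  cubic v with vertex-view v
  ... | at-X j = degree-edgesAt graph (star-unique j j) (edgesAt-X j)
  ... | at-Y i = degree-edgesAt graph (star-unique (prev i) i) (edgesAt-Y i)

  bridgeless : Bridgeless graph
  bridgeless e with edge-view e
  ... | digon-edge 0F j =
    not-bridge graph (digon-joins 0F j) (reach-edge graph (digon₀≢digon₁ j j ∘ sym) (digon-joins 1F j))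
  ... | digon-edge 1F j =
    not-bridge graph (digon-joins 1F j) (reach-edge graph (digon₀≢digon₁ j j) (digon-joins 0F j))
  ... | connector-edge p = not-bridge graph (connector-joins p)
    (reach-trans graph (reach-sym graph (across (prev p)))
                       (CyclicChain.missing-link (reach-setoid graph (connector p)) X p link))
    where
    across : ∀ j → ReachAvoiding graph (connector p) (X j) (Y j)
    across j = reach-edge graph (digon≢connector 0F j p) (digon-joins 0F j)
    link : ∀ i → i ≢ p → ReachAvoiding graph (connector p) (X (prev i)) (X i)
    link i i≢p = reach-trans graph (across (prev i))
      (reach-edge graph (i≢p ∘ combine-injectiveˡ i 2F p 2F) (connector-joins i))

  connectors : Subset (suc q * 3)
  connectors = blocks {suc q} (λ _ → ⁅ 2F ⁆)

  selection : (Fin (suc q) → Fin 2) → Subset (suc q * 3)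
  selection s = blocks (λ j → ⁅ inject₁ (s j) ⁆)

  ∣connectors∣ : ∣ connectors ∣ ≡ suc q
  ∣connectors∣ = size (suc q)
    where
    size : ∀ k → ∣ blocks {k} {3} (λ _ → ⁅ 2F ⁆) ∣ ≡ k
    size zero    = refl
    size (suc k) = cong suc (size k)

  ∈-connectors : ∀ j t → combine j t ∈ connectors ⇔ t ≡ 2F
  ∈-connectors j t = ⇔.trans (∈-blocks {suc q} (λ _ → ⁅ 2F ⁆) j t) x∈⁅y⁆⇔x≡y

  ∈-selection : ∀ s j t → combine j t ∈ selection s ⇔ t ≡ inject₁ (s j)
  ∈-selection s j t = ⇔.trans (∈-blocks {suc q} (λ j → ⁅ inject₁ (s j) ⁆) j t) x∈⁅y⁆⇔x≡y

  connector∈connectors : ∀ j → connector j ∈ connectors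
  connector∈connectors j = Equivalence.from (∈-connectors j 2F) refl

  digon∉connectors : ∀ t j → digon t j ∉ connectors
  digon∉connectors t j = fromℕ≢inject₁ ∘ sym ∘ Equivalence.to (∈-connectors j (inject₁ t))

  digon∈selection : ∀ s t j → digon t j ∈ selection s ⇔ t ≡ s j
  digon∈selection s t j = ⇔.trans (∈-selection s j (inject₁ t)) (mk⇔ inject₁-injective (cong inject₁))

  connector∉selection : ∀ s j → connector j ∉ selection s
  connector∉selection s j = fromℕ≢inject₁ ∘ Equivalence.to (∈-selection s j 2F)

  chosen∈selection : ∀ s j → digon (s j) j ∈ selection s
  chosen∈selection s j = Equivalence.from (digon∈selection s (s j) j) refl

  only-connector : ∀ j i → All (λ f → f ∈ connectors → f ≡ connector i) (star j i)
  only-connector j i =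
    (⊥-elim ∘ digon∉connectors 0F j) ∷ (⊥-elim ∘ digon∉connectors 1F j) ∷ (λ _ → refl) ∷ []

  only-chosen : ∀ s j i → All (λ f → f ∈ selection s → f ≡ digon (s j) j) (star j i)
  only-chosen s j i = (cong (λ t → digon t j) ∘ Equivalence.to (digon∈selection s 0F j))
                    ∷ (cong (λ t → digon t j) ∘ Equivalence.to (digon∈selection s 1F j))
                    ∷ (⊥-elim ∘ connector∉selection s i) ∷ []

  connectors-perfect : IsPerfectMatching graph connectors
  connectors-perfect v with vertex-view v
  ... | at-X j = covered-by graph (edgesAt-X j) (connector∈star j j)
                   (connector∈connectors j) (only-connector j j)
  ... | at-Y i = covered-by graph (edgesAt-Y i) (connector∈star (prev i) i)
                   (connector∈connectors i) (only-connector (prev i) i)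

  selection-perfect : ∀ s → IsPerfectMatching graph (selection s)
  selection-perfect s v with vertex-view v
  ... | at-X j = covered-by graph (edgesAt-X j) (digon∈star (s j) j j)
                   (chosen∈selection s j) (only-chosen s j j)
  ... | at-Y i = covered-by graph (edgesAt-Y i) (digon∈star (s (prev i)) (prev i) i)
                   (chosen∈selection s (prev i)) (only-chosen s (prev i) i)

  across-digon : ∀ {M x y} j i i′ → IsPerfectMatching graph M → EdgesAt graph x (star j i) →
                 EdgesAt graph y (star j i′) → connector i ∈ M → connector i′ ∈ M
  across-digon j i i′ pm at-x at-y c∈M =
    forced graph pm at-y (inj₂ (free 0F) ∷ inj₂ (free 1F) ∷ inj₁ refl ∷ [])
    where
    free : ∀ t → digon t j ∉ _
    free t = excluded graph pm c∈M (Equivalence.from (at-x _) (connector∈star j i))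
      (Equivalence.from (at-x _) (digon∈star t j i)) (digon≢connector t j i)

  connectors-⊆ : ∀ {M} j → IsPerfectMatching graph M → connector j ∈ M → connectors ⊆ M
  connectors-⊆ {M} j pm c∈M {f} f∈C with edge-view f
  ... | digon-edge t i   = ⊥-elim (digon∉connectors t i f∈C)
  ... | connector-edge i = Equivalence.to (all-equal i) (Equivalence.from (all-equal j) c∈M)
    where
    propagate : ∀ i → connector (prev i) ∈ M ⇔ connector i ∈ M
    propagate i = mk⇔ (across-digon (prev i) (prev i) i pm (edgesAt-X (prev i)) (edgesAt-Y i))
                      (across-digon (prev i) i (prev i) pm (edgesAt-Y i) (edgesAt-X (prev i)))
    all-equal : ∀ i → connector zero ∈ M ⇔ connector i ∈ M
    all-equal = CyclicChain.chain (⇔.⇔-setoid 0ℓ) (λ i → connector i ∈ M) (propagate ∘ suc)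

  connector-lonely : ∀ j → Lonely graph (connector j)
  connector-lonely j = connectors , connectors-perfect , connector∈connectors j ,
    λ M pm c∈M → ⊆-perfect⇒≡ graph pm connectors-perfect (connectors-⊆ j pm c∈M)

  digon-not-lonely : ∀ t j j′ → j′ ≢ j → ¬ Lonely graph (digon t j)
  digon-not-lonely t j j′ j′≢j = two-matchings⇒¬lonely graph
    (selection-perfect uniform) (selection-perfect switched) (chosen∈selection uniform j)
    (Equivalence.from (digon∈selection switched t j) (sym (updateAt-minimal j j′ uniform (j′≢j ∘ sym))))
    differ
    where
    uniform switched : Fin (suc q) → Fin 2
    uniform _ = t
    switched  = updateAt uniform j′ opposite
    opposite≢ : ∀ (t : Fin 2) → opposite t ≢ t
    opposite≢ 0F ()
    opposite≢ 1F ()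
    differ : selection uniform ≢ selection switched
    differ eq = opposite≢ t (sym (trans
      (Equivalence.to (digon∈selection switched t j′)
                      (subst (digon t j′ ∈_) eq (chosen∈selection uniform j′)))
      (updateAt-updates j′ uniform)))

  lonely-connectors : (∀ j → ∃ λ j′ → j′ ≢ j) → HasExactlyLonely graph (suc q)
  lonely-connectors another = exactly-lonely graph connectors ∣connectors∣ lonely not-lonely
    where
    lonely : ∀ e → e ∈ connectors → Lonely graph e
    lonely e e∈C with edge-view e
    ... | digon-edge t j   = ⊥-elim (digon∉connectors t j e∈C)
    ... | connector-edge j = connector-lonely j
    not-lonely : ∀ e → e ∉ connectors → ¬ Lonely graph e
    not-lonely e e∉C with edge-view e
    ... | digon-edge t j   = digon-not-lonely t j (proj₁ (another j)) (proj₂ (another j))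
    ... | connector-edge j = ⊥-elim (e∉C (connector∈connectors j))

-- A ten-cycle with five chords

-- Cycle edge i joins prev i and i (so edge 0 is {9, 0}); edges 10 to 14 are the chords.
module TenCycle where
  open import Agda.Builtin.FromNat using (Number; fromNat)
  open import Data.Unit.Base using (tt)
  import Data.Nat.Literals
  import Data.Fin.Literals

  instance
    ℕ-number : Number ℕ
    ℕ-number = Data.Nat.Literals.number
    Fin-number : ∀ {n} → Number (Fin n)
    Fin-number = Data.Fin.Literals.number _

  chord : Fin 5 → Fin 10 × Fin 10
  chord = lookup ((0 , 5) ∷ (1 , 3) ∷ (2 , 9) ∷ (4 , 8) ∷ (6 , 7) ∷ [])

  endpoints : Fin 10 ⊎ Fin 5 → Fin 10 × Fin 10
  endpoints (inj₁ i) = prev i , i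
  endpoints (inj₂ c) = chord c

  end₁ end₂ : Fin 15 → Fin 10
  end₁ = proj₁ ∘ endpoints ∘ splitAt 10
  end₂ = proj₂ ∘ endpoints ∘ splitAt 10

  graph : Graph
  graph = record
    { n = 10 ; m = 15 ; end₁ = end₁ ; end₂ = end₂
    ; loopless = toWitness {a? = all? λ e → ¬? (end₁ e ≟ end₂ e)} _
    }

  cubic : Cubic graph
  cubic = toWitness {a? = all? λ v → degree graph v ℕ.≟ 3} _

  bridgeless : Bridgeless graph
  bridgeless = hamiltonian⇒bridgeless graph id (_↑ˡ 5) (λ v → v , refl) (↑ˡ-injective 5 _ _) cycle-edge
    where
    cycle-edge : ∀ i → Joins graph (i ↑ˡ 5) (prev i) i
    cycle-edge i = forward (cong (proj₁ ∘ endpoints) (splitAt-↑ˡ 10 i 5))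
                           (cong (proj₂ ∘ endpoints) (splitAt-↑ˡ 10 i 5))

  alternating : Subset 15
  alternating = fromList (0 ∷ 2 ∷ 4 ∷ 6 ∷ 8 ∷ [])

  matchings : Vec (Subset 15) 8
  matchings = alternating
            ∷ fromList (1 ∷ 3 ∷ 5 ∷ 7 ∷ 9 ∷ [])
            ∷ fromList (1 ∷ 3 ∷ 5 ∷ 9 ∷ 14 ∷ [])
            ∷ fromList (1 ∷ 4 ∷ 6 ∷ 8 ∷ 12 ∷ [])
            ∷ fromList (2 ∷ 4 ∷ 7 ∷ 9 ∷ 10 ∷ [])
            ∷ fromList (2 ∷ 4 ∷ 9 ∷ 10 ∷ 14 ∷ [])
            ∷ fromList (7 ∷ 10 ∷ 11 ∷ 12 ∷ 13 ∷ [])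
            ∷ fromList (10 ∷ 11 ∷ 12 ∷ 13 ∷ 14 ∷ [])
            ∷ []

  matchings-perfect : ∀ i → IsPerfectMatching graph (lookup matchings i)
  matchings-perfect = toWitness {a? = all? λ i → perfectMatching? graph (lookup matchings i)} _

  two-matchings : ∀ e → e ≢ 0 → ∃₂ λ i j →
    lookup matchings i ≢ lookup matchings j × e ∈ lookup matchings i × e ∈ lookup matchings j
  two-matchings = toWitness {a? = all? λ e → ¬? (e ≟ 0) →-dec any? λ i → any? λ j →
    ¬? (≡-dec Bool._≟_ (lookup matchings i) (lookup matchings j)) ×-dec
    (e ∈? lookup matchings i) ×-dec (e ∈? lookup matchings j)} _

  module _ (M : Subset 15) (pm : IsPerfectMatching graph M) (0∈M : 0 ∈ M) where

    excluded-at : ∀ v {e f} → e ∈ M → {True (incident? graph v e)} → {True (incident? graph v f)} →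
                  {False (f ≟ e)} → f ∉ M
    excluded-at v e∈M {v∈e} {v∈f} {f≢e} =
      excluded graph pm e∈M (toWitness v∈e) (toWitness v∈f) (toWitnessFalse f≢e)

    forced-at : ∀ v {f} → All (λ g → g ≡ f ⊎ g ∉ M) (incidentEdges graph v) → f ∈ M
    forced-at v = forced graph pm (edgesAt-incidentEdges graph v)

    9∉M : 9 ∉ M
    9∉M = excluded-at 9 0∈M

    10∉M : 10 ∉ M
    10∉M = excluded-at 0 0∈M

    12∉M : 12 ∉ M
    12∉M = excluded-at 9 0∈M

    5∉M : 5 ∉ M
    5∉M 5∈M = 6∉M (forced-at 6 (inj₁ refl ∷ inj₂ 7∉M ∷ inj₂ 14∉M ∷ []))
      where
      6∉M : 6 ∉ M
      6∉M = excluded-at 5 5∈M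
      8∈M : 8 ∈ M
      8∈M = forced-at 8 (inj₁ refl ∷ inj₂ 9∉M ∷ inj₂ (excluded-at 4 5∈M) ∷ [])
      7∉M : 7 ∉ M
      7∉M = excluded-at 7 8∈M
      14∉M : 14 ∉ M
      14∉M = excluded-at 7 8∈M

    6∈M : 6 ∈ M
    6∈M = forced-at 5 (inj₂ 5∉M ∷ inj₁ refl ∷ inj₂ 10∉M ∷ [])

    8∈M : 8 ∈ M
    8∈M = forced-at 7 (inj₂ (excluded-at 6 6∈M) ∷ inj₁ refl ∷ inj₂ (excluded-at 6 6∈M) ∷ [])

    4∈M : 4 ∈ M
    4∈M = forced-at 4 (inj₁ refl ∷ inj₂ 5∉M ∷ inj₂ (excluded-at 8 8∈M) ∷ [])

    2∈M : 2 ∈ M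
    2∈M = forced-at 2 (inj₁ refl ∷ inj₂ (excluded-at 3 4∈M) ∷ inj₂ 12∉M ∷ [])

    only-alternating : M ≡ alternating
    only-alternating =
      ⊆-perfect⇒≡ graph pm (matchings-perfect 0) (fromList-⊆ (0∈M ∷ 2∈M ∷ 4∈M ∷ 6∈M ∷ 8∈M ∷ []))

  lonely-0 : Lonely graph 0
  lonely-0 = alternating , matchings-perfect 0 , toWitness {a? = 0 ∈? alternating} _ , only-alternating

  exactly-one-lonely : HasExactlyLonely graph 1
  exactly-one-lonely = exactly-lonely graph ⁅ 0 ⁆ (∣⁅x⁆∣≡1 {n = 15} 0) lonely not-lonely
    where
    lonely : ∀ e → e ∈ ⁅ 0 ⁆ → Lonely graph e
    lonely e e∈ = subst (Lonely graph) (sym (x∈⁅y⁆⇒x≡y 0 e∈)) lonely-0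
    not-lonely : ∀ e → e ∉ ⁅ 0 ⁆ → ¬ Lonely graph e
    -- A `with` here would make the type checker normalise the proof found by `two-matchings`.
    not-lonely e e∉ = case two-matchings e (x∉⁅y⁆⇒x≢y e∉) of λ where
      (i , j , Mi≢Mj , e∈Mi , e∈Mj) →
        two-matchings⇒¬lonely graph (matchings-perfect i) (matchings-perfect j) e∈Mi e∈Mj Mi≢Mj

theorem3 : (k : ℕ) → 1 ≤ k →
    Σ Graph λ G → Cubic G × Bridgeless G × HasExactlyLonely G k
theorem3 zero ()
theorem3 (suc zero) _ =
  TenCycle.graph , TenCycle.cubic , TenCycle.bridgeless , TenCycle.exactly-one-lonely
theorem3 (suc (suc q)) _ =
  Ring.graph (suc q) , Ring.cubic (suc q) , Ring.bridgeless (suc q) ,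
  Ring.lonely-connectors (suc q) (λ j → punchIn j zero , punchInᵢ≢i j zero)
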